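{- For positive integers $m$ and $n$, let $H_n^{(m)}=\sum_{k=1}^n \frac{1}{k^m}$ denote the harmonic number of order $m$. Then for every positive integer $m$, the sequence $\left(\sqrt[n+1]{H_{n+1}^{(m)}}/\sqrt[n]{H_n^{(m)}}\right)_{n\geq 3}$ is strictly increasing. -}

module Defs where

open import Data.Nat as ℕ using (ℕ; zero; suc)
open import Data.Nat.Properties using (m^n≢0)
open import Data.Integer using (+_)
open import Data.Rational using (ℚ; _/_; _+_; _*_; _<_; 0ℚ; 1ℚ)
open import Data.List using (List; []; _∷_; _++_; foldr)
open import Data.Product using (_×_; _,_)

_^ℚ_ : ℚ → ℕ → ℚ
q ^ℚ zero  = 1ℚ
q ^ℚ suc e = q * (q ^ℚ e)

H : ℕ → ℕ → ℚ
H m zero    = 0ℚ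
H m (suc i) = H m i + ((+ 1) / (suc i ℕ.^ m)) {{m^n≢0 (suc i) m}}

-- A factor (q , a , k) denotes the positive real number q^(a/(k+1))
-- (q is always a positive rational in our uses).
-- A radical expression is a finite product of such factors.

Factor : Set
Factor = ℚ × ℕ × ℕ

Rad : Set
Rad = List Factor

root : (k : ℕ) → ℚ → Factor
root k q = (q , 1 , k)

index : Rad → ℕ
index = foldr (λ { (_ , _ , k) L → suc k ℕ.* L }) 1

-- the rational number x^L, valid when every root index divides L
powRad : Rad → ℕ → ℚ
powRad [] L = 1ℚ
powRad ((q , a , k) ∷ x) L = (q ^ℚ (a ℕ.* (L ℕ./ suc k))) * powRad x L

-- strict order of positive reals x < y, decided by x^L < y^L for
-- L a common multiple of all root indices (t ↦ t^L is strictly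
-- increasing on positive reals)
_<ᴿ_ : Rad → Rad → Set
x <ᴿ y = powRad x L < powRad y L
  where L = index (x ++ y)

-- quotients x / y of positive radicals, and their strict order:
-- x₁/x₂ < y₁/y₂  iff  x₁·y₂ < y₁·x₂ (all quantities positive)
RadQuot : Set
RadQuot = Rad × Rad

_<Q_ : RadQuot → RadQuot → Set
(x₁ , x₂) <Q (y₁ , y₂) = (x₁ ++ y₂) <ᴿ (y₁ ++ x₂)

-- the n-th term ( H_{n+1}^{(m)} )^{1/(n+1)} / ( H_n^{(m)} )^{1/n}, n ≥ 1,
-- written for n = suc j
term : (m j : ℕ) → RadQuot
term m j = (root (suc j) (H m (suc (suc j))) ∷ []) , (root j (H m (suc j)) ∷ [])

-- Write a = H_n, b = H_{n+1} = a + p and c = H_{n+2} = b + q, where p = (n+1)^(-m) and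
-- q = (n+2)^(-m). The claim is b^(2/(n+1)) < a^(1/n) c^(1/(n+2)), i.e. after raising to the power
-- n(n+1)(n+2) it is b^(2n) (b²)^(n(n+1)) < a^(2n) (ac)^(n(n+1)) a². As b² = ac + e with
-- e = a(p - q) + p², the Padé-type estimate (A + D)^N (2A - ND) ≤ A^N (2A + ND) applied to both
-- powers on the left reduces this to the polynomial inequality
-- (a + np)(2ac + E) < a²(a - np)(2ac - E), E = n(n+1)e, which follows from
-- (a² + 1)(2anp + E) < 2a²(a² - 1). Bounding p - q by the mean value theorem, this last inequality
-- holds for n ≥ 3 because a ≥ 1 + 2^(-m) when m ≥ 3, a ≥ H_3 = 49/36 when m = 2, and a ≥ H_7 > 5/2
-- when m = 1 and n ≥ 7; the remaining cases m = 1, 3 ≤ n ≤ 6 are decided by exact arithmetic.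
module Submission where

open import Defs

module HarmonicRatios where
  open import Data.Nat as ℕ using (ℕ; zero; suc)
  import Data.Nat.Properties as ℕₚ
  open import Data.Nat.DivMod using (m*n/n≡m)
  open import Data.Nat.Coprimality as Coprime using ()
  open import Data.Integer as ℤ using (+_)
  import Data.Integer.Properties as ℤₚ
  open import Data.Rational using (ℚ; mkℚ; 0ℚ; 1ℚ; _+_; _*_; _-_; -_; _≤_; _<_; _/_; *≤*; *<*; positive; nonNegative)
  open import Data.Rational.Properties
  open import Data.Maybe using (Maybe; just; nothing)
  open import Data.List using (_∷_; []; _++_)
  open import Data.Product using (_×_; _,_)
  open import Data.Sum using (inj₁; inj₂)
  open import Relation.Nullary using (Dec; yes; no)
  open import Relation.Nullary.Decidable using (toWitness)
  open import Relation.Binary.PropositionalEquality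
  open import Tactic.RingSolver.Core.AlmostCommutativeRing using (AlmostCommutativeRing; fromCommutativeRing)
  open import Tactic.RingSolver using (solve-∀; solve)
  import Data.Nat.Tactic.RingSolver as ℕ-Solver
  open import Algebra.Bundles using (CommutativeMonoid)
  open import Algebra.Properties.CommutativeSemigroup (CommutativeMonoid.commutativeSemigroup *-1-commutativeMonoid)
    using () renaming (interchange to *-interchange)

  ℚ-ring : AlmostCommutativeRing _ _
  ℚ-ring = fromCommutativeRing +-*-commutativeRing isZero
    where
    isZero : ∀ x → Maybe (0ℚ ≡ x)
    isZero x with 0ℚ ≟ x
    ... | yes 0≡x = just 0≡x
    ... | no _    = nothing

  fromℕ : ℕ → ℚ
  fromℕ k = mkℚ (+ k) 0 (Coprime.sym (Coprime.1-coprimeTo k))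

  fromℕ≡/1 : ∀ k → + k / 1 ≡ fromℕ k
  fromℕ≡/1 k = ↥p/↧p≡p (fromℕ k)

  fromℕ-+ : ∀ k l → fromℕ (k ℕ.+ l) ≡ fromℕ k + fromℕ l
  fromℕ-+ k l = trans (sym (fromℕ≡/1 (k ℕ.+ l)))
    (cong (_/ 1) (cong₂ ℤ._+_ (sym (ℤₚ.*-identityʳ (+ k))) (sym (ℤₚ.*-identityʳ (+ l)))))

  fromℕ-suc : ∀ k → fromℕ (suc k) ≡ 1ℚ + fromℕ k
  fromℕ-suc = fromℕ-+ 1

  fromℕ-* : ∀ k l → fromℕ (k ℕ.* l) ≡ fromℕ k * fromℕ l
  fromℕ-* k l = trans (sym (fromℕ≡/1 (k ℕ.* l))) (cong (_/ 1) (ℤₚ.pos-* k l))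

  fromℕ-mono-≤ : ∀ {k l} → k ℕ.≤ l → fromℕ k ≤ fromℕ l
  fromℕ-mono-≤ {k} {l} k≤l = *≤* (subst₂ ℤ._≤_
    (sym (ℤₚ.*-identityʳ (+ k))) (sym (ℤₚ.*-identityʳ (+ l))) (ℤ.+≤+ k≤l))

  fromℕ-mono-< : ∀ {k l} → k ℕ.< l → fromℕ k < fromℕ l
  fromℕ-mono-< {k} {l} k<l = *<* (subst₂ ℤ._<_
    (sym (ℤₚ.*-identityʳ (+ k))) (sym (ℤₚ.*-identityʳ (+ l))) (ℤ.+<+ k<l))

  fromℕ-nonNeg : ∀ k → 0ℚ ≤ fromℕ k
  fromℕ-nonNeg k = fromℕ-mono-≤ ℕ.z≤n

  fromℕ-*-inverse : ∀ d .{{_ : ℕ.NonZero d}} → fromℕ d * (+ 1 / d) ≡ 1ℚ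
  fromℕ-*-inverse (suc k) =
    trans (cong (fromℕ (suc k) *_) (↥p/↧p≡p (mkℚ (+ 1) k (Coprime.1-coprimeTo (suc k)))))
          (*-inverseʳ (fromℕ (suc k)))

  0<1 : 0ℚ < 1ℚ
  0<1 = positive⁻¹ 1ℚ

  0≤1 : 0ℚ ≤ 1ℚ
  0≤1 = <⇒≤ 0<1

  p≤q⇒0≤q-p : ∀ {p q} → p ≤ q → 0ℚ ≤ q - p
  p≤q⇒0≤q-p {p} {q} p≤q = subst (_≤ q - p) (+-inverseʳ p) (+-monoˡ-≤ (- p) p≤q)

  p<q⇒0<q-p : ∀ {p q} → p < q → 0ℚ < q - p
  p<q⇒0<q-p {p} {q} p<q = subst (_< q - p) (+-inverseʳ p) (+-monoˡ-< (- p) p<q)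

  p+[q-p]≡q : ∀ p q → p + (q - p) ≡ q
  p+[q-p]≡q = solve-∀ ℚ-ring

  [p+q]-p≡q : ∀ p q → (p + q) - p ≡ q
  [p+q]-p≡q = solve-∀ ℚ-ring

  0≤q-p⇒p≤q : ∀ {p q} → 0ℚ ≤ q - p → p ≤ q
  0≤q-p⇒p≤q {p} {q} h = subst₂ _≤_ (+-identityʳ p) (p+[q-p]≡q p q) (+-monoʳ-≤ p h)

  0<q-p⇒p<q : ∀ {p q} → 0ℚ < q - p → p < q
  0<q-p⇒p<q {p} {q} h = subst₂ _<_ (+-identityʳ p) (p+[q-p]≡q p q) (+-monoʳ-< p h)

  *-nonNeg : ∀ {p q} → 0ℚ ≤ p → 0ℚ ≤ q → 0ℚ ≤ p * q
  *-nonNeg {p} {q} 0≤p 0≤q = nonNegative⁻¹ (p * q)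
    {{nonNeg*nonNeg⇒nonNeg p {{nonNegative 0≤p}} q {{nonNegative 0≤q}}}}

  *-pos : ∀ {p q} → 0ℚ < p → 0ℚ < q → 0ℚ < p * q
  *-pos {p} {q} 0<p 0<q = positive⁻¹ (p * q) {{pos*pos⇒pos p {{positive 0<p}} q {{positive 0<q}}}}

  *-monoʳ-≤′ : ∀ {p q r} → 0ℚ ≤ r → p ≤ q → p * r ≤ q * r
  *-monoʳ-≤′ {r = r} 0≤r = *-monoʳ-≤-nonNeg r {{nonNegative 0≤r}}

  *-monoˡ-≤′ : ∀ {p q r} → 0ℚ ≤ r → p ≤ q → r * p ≤ r * q
  *-monoˡ-≤′ {r = r} 0≤r = *-monoˡ-≤-nonNeg r {{nonNegative 0≤r}}

  *-monoʳ-<′ : ∀ {p q r} → 0ℚ < r → p < q → p * r < q * r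
  *-monoʳ-<′ {r = r} 0<r = *-monoˡ-<-pos r {{positive 0<r}}

  *-monoˡ-<′ : ∀ {p q r} → 0ℚ < r → p < q → r * p < r * q
  *-monoˡ-<′ {r = r} 0<r = *-monoʳ-<-pos r {{positive 0<r}}

  *-mono-≤′ : ∀ {p p′ q q′} → 0ℚ ≤ p → 0ℚ ≤ q′ → p ≤ p′ → q ≤ q′ → p * q ≤ p′ * q′
  *-mono-≤′ 0≤p 0≤q′ p≤p′ q≤q′ = ≤-trans (*-monoˡ-≤′ 0≤p q≤q′) (*-monoʳ-≤′ 0≤q′ p≤p′)

  *-cancelʳ-≤′ : ∀ {p q r} → 0ℚ < r → p * r ≤ q * r → p ≤ q
  *-cancelʳ-≤′ {r = r} 0<r = *-cancelʳ-≤-pos r {{positive 0<r}}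

  *-cancelʳ-<′ : ∀ {p q r} → 0ℚ < r → p * r < q * r → p < q
  *-cancelʳ-<′ {r = r} 0<r = *-cancelʳ-<-nonNeg r {{nonNegative (<⇒≤ 0<r)}}

  0<p*r⇒0<p : ∀ {p r} → 0ℚ < r → 0ℚ < p * r → 0ℚ < p
  0<p*r⇒0<p {p} {r} 0<r 0<pr = *-cancelʳ-<′ 0<r (subst (_< p * r) (sym (*-zeroˡ r)) 0<pr)

  ≤-shift : ∀ {a₀ a} (P : ℚ → Set) → a₀ ≤ a → (∀ {u} → 0ℚ ≤ u → P (a₀ + u)) → P a
  ≤-shift {a₀} {a} P a₀≤a P[a₀+u] = subst P (p+[q-p]≡q a₀ a) (P[a₀+u] (p≤q⇒0≤q-p a₀≤a))

  horner-pos : ∀ {u} k₀ k₁ k₂ k₃ k₄ → 0ℚ ≤ u → 0ℚ < k₀ → 0ℚ ≤ k₁ → 0ℚ ≤ k₂ → 0ℚ ≤ k₃ → 0ℚ ≤ k₄ →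
    0ℚ < k₀ + u * (k₁ + u * (k₂ + u * (k₃ + u * k₄)))
  horner-pos _ _ _ _ _ 0≤u 0<k₀ 0≤k₁ 0≤k₂ 0≤k₃ 0≤k₄ =
    +-mono-<-≤ 0<k₀ (*-nonNeg 0≤u (+-mono-≤ 0≤k₁ (*-nonNeg 0≤u (+-mono-≤ 0≤k₂
      (*-nonNeg 0≤u (+-mono-≤ 0≤k₃ (*-nonNeg 0≤u 0≤k₄)))))))

  fromℕ-≤-cleared : ∀ {i j x y} w → 0ℚ ≤ w → fromℕ i * w ≡ x → fromℕ j * w ≡ y → i ℕ.≤ j → x ≤ y
  fromℕ-≤-cleared w 0≤w refl refl i≤j = *-monoʳ-≤′ 0≤w (fromℕ-mono-≤ i≤j)

  ^ℚ-distribˡ-+-* : ∀ x i j → x ^ℚ (i ℕ.+ j) ≡ x ^ℚ i * x ^ℚ j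
  ^ℚ-distribˡ-+-* x zero    j = sym (*-identityˡ (x ^ℚ j))
  ^ℚ-distribˡ-+-* x (suc i) j = trans (cong (x *_) (^ℚ-distribˡ-+-* x i j)) (sym (*-assoc x _ _))

  ^ℚ-distribʳ-* : ∀ x y i → (x * y) ^ℚ i ≡ x ^ℚ i * y ^ℚ i
  ^ℚ-distribʳ-* x y zero    = refl
  ^ℚ-distribʳ-* x y (suc i) = trans (cong ((x * y) *_) (^ℚ-distribʳ-* x y i)) (*-interchange x y _ _)

  1^ℚ : ∀ i → 1ℚ ^ℚ i ≡ 1ℚ
  1^ℚ zero    = refl
  1^ℚ (suc i) = trans (*-identityˡ _) (1^ℚ i)

  ^ℚ-*-assoc : ∀ x i j → (x ^ℚ i) ^ℚ j ≡ x ^ℚ (i ℕ.* j)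
  ^ℚ-*-assoc x zero    j = 1^ℚ j
  ^ℚ-*-assoc x (suc i) j = begin
    (x * x ^ℚ i) ^ℚ j           ≡⟨ ^ℚ-distribʳ-* x (x ^ℚ i) j ⟩
    x ^ℚ j * (x ^ℚ i) ^ℚ j      ≡⟨ cong (x ^ℚ j *_) (^ℚ-*-assoc x i j) ⟩
    x ^ℚ j * x ^ℚ (i ℕ.* j)     ≡⟨ ^ℚ-distribˡ-+-* x j (i ℕ.* j) ⟨
    x ^ℚ (j ℕ.+ i ℕ.* j)        ∎
    where open ≡-Reasoning

  ^ℚ-nonNeg : ∀ {x} i → 0ℚ ≤ x → 0ℚ ≤ x ^ℚ i
  ^ℚ-nonNeg zero    _   = 0≤1
  ^ℚ-nonNeg (suc i) 0≤x = *-nonNeg 0≤x (^ℚ-nonNeg i 0≤x)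

  ^ℚ-pos : ∀ {x} i → 0ℚ < x → 0ℚ < x ^ℚ i
  ^ℚ-pos zero    _   = 0<1
  ^ℚ-pos (suc i) 0<x = *-pos 0<x (^ℚ-pos i 0<x)

  ^ℚ-mono-≤ : ∀ {x y} i → 0ℚ ≤ x → x ≤ y → x ^ℚ i ≤ y ^ℚ i
  ^ℚ-mono-≤ zero    _   _   = ≤-refl
  ^ℚ-mono-≤ (suc i) 0≤x x≤y =
    *-mono-≤′ 0≤x (^ℚ-nonNeg i (≤-trans 0≤x x≤y)) x≤y (^ℚ-mono-≤ i 0≤x x≤y)

  ^ℚ-mono-< : ∀ {x y} i → 0ℚ ≤ x → x < y → x ^ℚ suc i < y ^ℚ suc i
  ^ℚ-mono-< i 0≤x x<y = ≤-<-trans (*-monoˡ-≤′ 0≤x (^ℚ-mono-≤ i 0≤x (<⇒≤ x<y)))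
                                  (*-monoʳ-<′ (^ℚ-pos i (≤-<-trans 0≤x x<y)) x<y)

  0<x-[1+k]d⇒0<x-kd : ∀ x k {d} → 0ℚ ≤ d → 0ℚ < x - (1ℚ + k) * d → 0ℚ < x - k * d
  0<x-[1+k]d⇒0<x-kd x k {d} 0≤d 0<x-[1+k]d = begin-strict
    0ℚ                        <⟨ +-mono-<-≤ 0<x-[1+k]d 0≤d ⟩
    (x - (1ℚ + k) * d) + d    ≡⟨ solve (x ∷ k ∷ d ∷ []) ℚ-ring ⟩
    x - k * d                 ∎
    where open ≤-Reasoning

  padé-step : ∀ {A D K P Q} → 0ℚ < A → 0ℚ ≤ D → 0ℚ ≤ K → 0ℚ ≤ Q →
    0ℚ < (A + A) - (1ℚ + K) * D →
    P * ((A + A) - K * D) ≤ Q * ((A + A) + K * D) →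
    ((A + D) * P) * ((A + A) - (1ℚ + K) * D) ≤ (A * Q) * ((A + A) + (1ℚ + K) * D)
  padé-step {A} {D} {K} {P} {Q} 0<A 0≤D 0≤K 0≤Q 0<s hyp = *-cancelʳ-≤′ (0<x-[1+k]d⇒0<x-kd (A + A) K 0≤D 0<s) (begin
    ((A + D) * P) * ((A + A) - (1ℚ + K) * D) * ((A + A) - K * D)
      ≡⟨ solve (A ∷ D ∷ K ∷ P ∷ []) ℚ-ring ⟩
    (P * ((A + A) - K * D)) * ((A + D) * ((A + A) - (1ℚ + K) * D))
      ≤⟨ *-monoʳ-≤′ (*-nonNeg (+-mono-≤ (<⇒≤ 0<A) 0≤D) (<⇒≤ 0<s)) hyp ⟩
    (Q * ((A + A) + K * D)) * ((A + D) * ((A + A) - (1ℚ + K) * D))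
      ≤⟨ 0≤q-p⇒p≤q (begin
           0ℚ
             ≤⟨ *-nonNeg 0≤Q (+-mono-≤ (+-mono-≤ AD² AD²)
                  (*-nonNeg (*-nonNeg 0≤K (+-mono-≤ 0≤1 0≤K)) (*-nonNeg 0≤D (*-nonNeg 0≤D 0≤D)))) ⟩
           Q * ((A * (D * D) + A * (D * D)) + (K * (1ℚ + K)) * (D * (D * D)))
             ≡⟨ solve (A ∷ D ∷ K ∷ Q ∷ []) ℚ-ring ⟩
           (A * Q) * ((A + A) + (1ℚ + K) * D) * ((A + A) - K * D)
             - (Q * ((A + A) + K * D)) * ((A + D) * ((A + A) - (1ℚ + K) * D)) ∎) ⟩
    (A * Q) * ((A + A) + (1ℚ + K) * D) * ((A + A) - K * D) ∎)
    where
    open ≤-Reasoning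
    AD² : 0ℚ ≤ A * (D * D)
    AD² = *-nonNeg (<⇒≤ 0<A) (*-nonNeg 0≤D 0≤D)

  padé-bound : ∀ N {A D} → 0ℚ < A → 0ℚ ≤ D → 0ℚ < (A + A) - fromℕ N * D →
    (A + D) ^ℚ N * ((A + A) - fromℕ N * D) ≤ A ^ℚ N * ((A + A) + fromℕ N * D)
  padé-bound zero    {A} {D} _ _ _ = ≤-reflexive (solve (A ∷ D ∷ []) ℚ-ring)
  padé-bound (suc N) {A} {D} 0<A 0≤D 0<x = subst Padé (sym (fromℕ-suc N))
    (padé-step 0<A 0≤D (fromℕ-nonNeg N) (^ℚ-nonNeg N (<⇒≤ 0<A)) 0<x′
      (padé-bound N 0<A 0≤D (0<x-[1+k]d⇒0<x-kd (A + A) (fromℕ N) 0≤D 0<x′)))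
    where
    Padé : ℚ → Set
    Padé K = (A + D) ^ℚ suc N * ((A + A) - K * D) ≤ A ^ℚ suc N * ((A + A) + K * D)
    0<x′ : 0ℚ < (A + A) - (1ℚ + fromℕ N) * D
    0<x′ = subst (λ K → 0ℚ < (A + A) - K * D) (fromℕ-suc N) 0<x

  -- b^(2/(n+1)) < a^(1/n) c^(1/(n+2)), raised to the power n(n+1)(n+2)
  StrictlyLogConvexRoots : ℕ → ℚ → ℚ → ℚ → Set
  StrictlyLogConvexRoots n a b c =
    b ^ℚ (2 ℕ.* (n ℕ.* suc (suc n))) < a ^ℚ (suc n ℕ.* suc (suc n)) * c ^ℚ (n ℕ.* suc n)

  1*[m/n]≡ : ∀ m o n .{{_ : ℕ.NonZero n}} → m ≡ o ℕ.* n → 1 ℕ.* (m ℕ./ n) ≡ o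
  1*[m/n]≡ _ o n refl = trans (ℕₚ.*-identityˡ _) (m*n/n≡m o n)

  -- With n = suc k, _<ᴿ_ raises both products to the power L = n(n+1)²(n+2), their common root index.
  strictlyLogConvexRoots⇒<ᴿ : ∀ k {a b c} → 0ℚ ≤ b → StrictlyLogConvexRoots (suc k) a b c →
    (root (suc k) b ∷ root (suc k) b ∷ []) <ᴿ (root (suc (suc k)) c ∷ root k a ∷ [])
  strictlyLogConvexRoots⇒<ᴿ k {a} {b} {c} 0≤b convex =
    subst₂ _<_ lhs rhs (^ℚ-mono-< n (^ℚ-nonNeg (2 ℕ.* (n ℕ.* suc (suc n))) 0≤b) convex)
    where
    open ≡-Reasoning
    n = suc k
    L = suc n ℕ.* (suc n ℕ.* (suc (suc n) ℕ.* (n ℕ.* 1)))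
    eₐ = (suc n ℕ.* suc (suc n)) ℕ.* suc n
    e_b = n ℕ.* (suc n ℕ.* suc (suc n))
    e_c = (n ℕ.* suc n) ℕ.* suc n
    exp-a : 1 ℕ.* (L ℕ./ n) ≡ eₐ
    exp-a = 1*[m/n]≡ L eₐ n (identity n)
      where
      identity : ∀ n → suc n ℕ.* (suc n ℕ.* (suc (suc n) ℕ.* (n ℕ.* 1))) ≡ ((suc n ℕ.* suc (suc n)) ℕ.* suc n) ℕ.* n
      identity = ℕ-Solver.solve-∀
    exp-b : 1 ℕ.* (L ℕ./ suc n) ≡ e_b
    exp-b = 1*[m/n]≡ L e_b (suc n) (identity n)
      where
      identity : ∀ n → suc n ℕ.* (suc n ℕ.* (suc (suc n) ℕ.* (n ℕ.* 1))) ≡ (n ℕ.* (suc n ℕ.* suc (suc n))) ℕ.* suc n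
      identity = ℕ-Solver.solve-∀
    exp-c : 1 ℕ.* (L ℕ./ suc (suc n)) ≡ e_c
    exp-c = 1*[m/n]≡ L e_c (suc (suc n)) (identity n)
      where
      identity : ∀ n → suc n ℕ.* (suc n ℕ.* (suc (suc n) ℕ.* (n ℕ.* 1))) ≡ ((n ℕ.* suc n) ℕ.* suc n) ℕ.* suc (suc n)
      identity = ℕ-Solver.solve-∀
    A = a ^ℚ (1 ℕ.* (L ℕ./ n))
    C = c ^ℚ (1 ℕ.* (L ℕ./ suc (suc n)))
    double : ∀ n → 2 ℕ.* (n ℕ.* suc (suc n)) ℕ.* suc n ≡ n ℕ.* (suc n ℕ.* suc (suc n)) ℕ.+ n ℕ.* (suc n ℕ.* suc (suc n))
    double = ℕ-Solver.solve-∀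
    lhs : (b ^ℚ (2 ℕ.* (n ℕ.* suc (suc n)))) ^ℚ suc n ≡ b ^ℚ (1 ℕ.* (L ℕ./ suc n)) * (b ^ℚ (1 ℕ.* (L ℕ./ suc n)) * 1ℚ)
    lhs = begin
      (b ^ℚ (2 ℕ.* (n ℕ.* suc (suc n)))) ^ℚ suc n  ≡⟨ ^ℚ-*-assoc b (2 ℕ.* (n ℕ.* suc (suc n))) (suc n) ⟩
      b ^ℚ (2 ℕ.* (n ℕ.* suc (suc n)) ℕ.* suc n)  ≡⟨ cong (b ^ℚ_) (double n) ⟩
      b ^ℚ (e_b ℕ.+ e_b)                          ≡⟨ ^ℚ-distribˡ-+-* b e_b e_b ⟩
      b ^ℚ e_b * b ^ℚ e_b                        ≡⟨ cong₂ (λ i j → b ^ℚ i * j) exp-b (trans (*-identityʳ _) (cong (b ^ℚ_) exp-b)) ⟨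
      b ^ℚ (1 ℕ.* (L ℕ./ suc n)) * (b ^ℚ (1 ℕ.* (L ℕ./ suc n)) * 1ℚ) ∎
    rhs : (a ^ℚ (suc n ℕ.* suc (suc n)) * c ^ℚ (n ℕ.* suc n)) ^ℚ suc n
          ≡ c ^ℚ (1 ℕ.* (L ℕ./ suc (suc n))) * (a ^ℚ (1 ℕ.* (L ℕ./ n)) * 1ℚ)
    rhs = begin
      (a ^ℚ (suc n ℕ.* suc (suc n)) * c ^ℚ (n ℕ.* suc n)) ^ℚ suc n
        ≡⟨ ^ℚ-distribʳ-* (a ^ℚ (suc n ℕ.* suc (suc n))) (c ^ℚ (n ℕ.* suc n)) (suc n) ⟩
      (a ^ℚ (suc n ℕ.* suc (suc n))) ^ℚ suc n * (c ^ℚ (n ℕ.* suc n)) ^ℚ suc n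
        ≡⟨ cong₂ _*_ (^ℚ-*-assoc a (suc n ℕ.* suc (suc n)) (suc n)) (^ℚ-*-assoc c (n ℕ.* suc n) (suc n)) ⟩
      a ^ℚ eₐ * c ^ℚ e_c
        ≡⟨ cong₂ (λ i j → a ^ℚ i * c ^ℚ j) exp-a exp-c ⟨
      a ^ℚ (1 ℕ.* (L ℕ./ n)) * c ^ℚ (1 ℕ.* (L ℕ./ suc (suc n)))
        ≡⟨ trans (cong (C *_) (*-identityʳ A)) (*-comm C A) ⟨
      c ^ℚ (1 ℕ.* (L ℕ./ suc (suc n))) * (a ^ℚ (1 ℕ.* (L ℕ./ n)) * 1ℚ) ∎

  _<Q?_ : ∀ x y → Dec (x <Q y)
  (x₁ , x₂) <Q? (y₁ , y₂) = powRad (x₁ ++ y₂) L <? powRad (y₁ ++ x₂) L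
    where L = index ((x₁ ++ y₂) ++ (y₁ ++ x₂))

  product-form⇒strictlyLogConvexRoots : ∀ n {a b c} →
    b ^ℚ (n ℕ.+ n) * (b * b) ^ℚ (n ℕ.* suc n) < a ^ℚ (n ℕ.+ n) * ((a * c) ^ℚ (n ℕ.* suc n) * (a * a)) →
    StrictlyLogConvexRoots n a b c
  product-form⇒strictlyLogConvexRoots n {a} {b} {c} = subst₂ _<_ lhs rhs
    where
    open ≡-Reasoning
    N = n ℕ.* suc n
    lhs : b ^ℚ (n ℕ.+ n) * (b * b) ^ℚ N ≡ b ^ℚ (2 ℕ.* (n ℕ.* suc (suc n)))
    lhs = begin
      b ^ℚ (n ℕ.+ n) * (b * b) ^ℚ N        ≡⟨ cong (b ^ℚ (n ℕ.+ n) *_) (^ℚ-distribʳ-* b b N) ⟩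
      b ^ℚ (n ℕ.+ n) * (b ^ℚ N * b ^ℚ N)   ≡⟨ cong (b ^ℚ (n ℕ.+ n) *_) (^ℚ-distribˡ-+-* b N N) ⟨
      b ^ℚ (n ℕ.+ n) * b ^ℚ (N ℕ.+ N)      ≡⟨ ^ℚ-distribˡ-+-* b (n ℕ.+ n) (N ℕ.+ N) ⟨
      b ^ℚ ((n ℕ.+ n) ℕ.+ (N ℕ.+ N))       ≡⟨ cong (b ^ℚ_) (exponent n) ⟩
      b ^ℚ (2 ℕ.* (n ℕ.* suc (suc n)))     ∎
      where
      exponent : ∀ n → (n ℕ.+ n) ℕ.+ (n ℕ.* suc n ℕ.+ n ℕ.* suc n) ≡ 2 ℕ.* (n ℕ.* suc (suc n))
      exponent = ℕ-Solver.solve-∀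
    rhs : a ^ℚ (n ℕ.+ n) * ((a * c) ^ℚ N * (a * a)) ≡ a ^ℚ (suc n ℕ.* suc (suc n)) * c ^ℚ N
    rhs = begin
      a ^ℚ (n ℕ.+ n) * ((a * c) ^ℚ N * (a * a))              ≡⟨ cong (λ x → a ^ℚ (n ℕ.+ n) * (x * (a * a))) (^ℚ-distribʳ-* a c N) ⟩
      a ^ℚ (n ℕ.+ n) * ((a ^ℚ N * c ^ℚ N) * (a * a))        ≡⟨ rearrange (a ^ℚ (n ℕ.+ n)) (a ^ℚ N) (c ^ℚ N) a ⟩
      (a ^ℚ (n ℕ.+ n) * a ^ℚ N) * a ^ℚ 2 * c ^ℚ N           ≡⟨ cong (λ x → x * a ^ℚ 2 * c ^ℚ N) (^ℚ-distribˡ-+-* a (n ℕ.+ n) N) ⟨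
      a ^ℚ ((n ℕ.+ n) ℕ.+ N) * a ^ℚ 2 * c ^ℚ N              ≡⟨ cong (_* c ^ℚ N) (^ℚ-distribˡ-+-* a ((n ℕ.+ n) ℕ.+ N) 2) ⟨
      a ^ℚ ((n ℕ.+ n) ℕ.+ N ℕ.+ 2) * c ^ℚ N                 ≡⟨ cong (λ i → a ^ℚ i * c ^ℚ N) (exponent n) ⟩
      a ^ℚ (suc n ℕ.* suc (suc n)) * c ^ℚ N                 ∎
      where
      rearrange : ∀ x y z a → x * ((y * z) * (a * a)) ≡ (x * y) * (a * (a * 1ℚ)) * z
      rearrange = solve-∀ ℚ-ring
      exponent : ∀ n → (n ℕ.+ n) ℕ.+ n ℕ.* suc n ℕ.+ 2 ≡ suc n ℕ.* suc (suc n)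
      exponent = ℕ-Solver.solve-∀

  padé-criterion : ∀ n {a p q} → 0ℚ < a → 0ℚ ≤ p → 0ℚ ≤ q → q ≤ p →
    let s = fromℕ n * p
        c = (a + p) + q
        E = fromℕ (n ℕ.* suc n) * (a * (p - q) + p * p) in
    0ℚ < a - s → 0ℚ < (a * c + a * c) - E →
    (a + s) * ((a * c + a * c) + E) < (a * a) * ((a - s) * ((a * c + a * c) - E)) →
    StrictlyLogConvexRoots n a (a + p) ((a + p) + q)
  padé-criterion n {a} {p} {q} 0<a 0≤p 0≤q q≤p 0<a-s 0<r₂ key =
    product-form⇒strictlyLogConvexRoots n (*-cancelʳ-<′ (*-pos 0<r₁ 0<r₂) (begin-strict
      (b ^ℚ (n ℕ.+ n) * (b * b) ^ℚ N) * (r₁ * r₂)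
        ≡⟨ *-interchange (b ^ℚ (n ℕ.+ n)) ((b * b) ^ℚ N) r₁ r₂ ⟩
      (b ^ℚ (n ℕ.+ n) * r₁) * ((b * b) ^ℚ N * r₂)
        ≤⟨ *-mono-≤′ (*-nonNeg (^ℚ-nonNeg (n ℕ.+ n) 0≤b) (<⇒≤ 0<r₁)) (*-nonNeg (^ℚ-nonNeg N 0≤ac) 0≤t₂)
                     padé-b padé-b² ⟩
      (a ^ℚ (n ℕ.+ n) * t₁) * ((a * c) ^ℚ N * t₂)
        ≡⟨ collect-t (a ^ℚ (n ℕ.+ n)) ((a * c) ^ℚ N) a (fromℕ n) p t₂ ⟩
      (P + P) * ((a + s) * t₂)
        <⟨ *-monoˡ-<′ (+-mono-<-≤ 0<P (<⇒≤ 0<P)) key ⟩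
      (P + P) * ((a * a) * ((a - s) * r₂))
        ≡⟨ collect-r (a ^ℚ (n ℕ.+ n)) ((a * c) ^ℚ N) a (fromℕ n) p r₂ ⟩
      (a ^ℚ (n ℕ.+ n) * ((a * c) ^ℚ N * (a * a))) * (r₁ * r₂) ∎))
    where
    open ≤-Reasoning
    ν = fromℕ n
    N = n ℕ.* suc n
    b = a + p
    c = b + q
    s = ν * p
    e = a * (p - q) + p * p
    E = fromℕ N * e
    r₁ = (a + a) - (ν + ν) * p
    t₁ = (a + a) + (ν + ν) * p
    r₂ = (a * c + a * c) - E
    t₂ = (a * c + a * c) + E
    P = a ^ℚ (n ℕ.+ n) * (a * c) ^ℚ N
    0≤b : 0ℚ ≤ b
    0≤b = +-mono-≤ (<⇒≤ 0<a) 0≤p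
    0<ac : 0ℚ < a * c
    0<ac = *-pos 0<a (+-mono-<-≤ (+-mono-<-≤ 0<a 0≤p) 0≤q)
    0≤ac : 0ℚ ≤ a * c
    0≤ac = <⇒≤ 0<ac
    0≤e : 0ℚ ≤ e
    0≤e = +-mono-≤ (*-nonNeg (<⇒≤ 0<a) (p≤q⇒0≤q-p q≤p)) (*-nonNeg 0≤p 0≤p)
    0≤t₂ : 0ℚ ≤ t₂
    0≤t₂ = +-mono-≤ (+-mono-≤ 0≤ac 0≤ac) (*-nonNeg (fromℕ-nonNeg N) 0≤e)
    0<P : 0ℚ < P
    0<P = *-pos (^ℚ-pos (n ℕ.+ n) 0<a) (^ℚ-pos N 0<ac)
    r₁≡2[a-s] : ∀ a ν p → (a + a) - (ν + ν) * p ≡ (a - ν * p) + (a - ν * p)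
    r₁≡2[a-s] = solve-∀ ℚ-ring
    0<r₁ : 0ℚ < r₁
    0<r₁ = subst (0ℚ <_) (sym (r₁≡2[a-s] a ν p)) (+-mono-< 0<a-s 0<a-s)
    padé-b : b ^ℚ (n ℕ.+ n) * r₁ ≤ a ^ℚ (n ℕ.+ n) * t₁
    padé-b = subst (λ K → b ^ℚ (n ℕ.+ n) * ((a + a) - K * p) ≤ a ^ℚ (n ℕ.+ n) * ((a + a) + K * p))
      (fromℕ-+ n n) (padé-bound (n ℕ.+ n) 0<a 0≤p (subst (λ K → 0ℚ < (a + a) - K * p) (sym (fromℕ-+ n n)) 0<r₁))
    b²≡ac+e : ∀ a p q → a * ((a + p) + q) + (a * (p - q) + p * p) ≡ (a + p) * (a + p)
    b²≡ac+e = solve-∀ ℚ-ring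
    padé-b² : (b * b) ^ℚ N * ((a * c + a * c) - E) ≤ (a * c) ^ℚ N * t₂
    padé-b² = subst (λ x → x ^ℚ N * ((a * c + a * c) - E) ≤ (a * c) ^ℚ N * t₂) (b²≡ac+e a p q)
      (padé-bound N 0<ac 0≤e 0<r₂)
    collect-t : ∀ x y a ν p t → (x * ((a + a) + (ν + ν) * p)) * (y * t) ≡ (x * y + x * y) * ((a + ν * p) * t)
    collect-t = solve-∀ ℚ-ring
    collect-r : ∀ x y a ν p r → (x * y + x * y) * ((a * a) * ((a - ν * p) * r)) ≡ (x * (y * (a * a))) * (((a + a) - (ν + ν) * p) * r)
    collect-r = solve-∀ ℚ-ring

  BelowMargin : ℚ → ℚ → Set
  BelowMargin a X = (a * a + 1ℚ) * X < (a * a) * ((a * a - 1ℚ) + (a * a - 1ℚ))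

  belowMargin-antimono : ∀ {a X Y} → 0ℚ ≤ a → X ≤ Y → BelowMargin a Y → BelowMargin a X
  belowMargin-antimono 0≤a X≤Y = ≤-<-trans (*-monoˡ-≤′ (+-mono-≤ (*-nonNeg 0≤a 0≤a) 0≤1) X≤Y)

  padé-conditions : ∀ {a c s E} → 1ℚ ≤ a → a ≤ c → 0ℚ ≤ s → 0ℚ ≤ E →
    BelowMargin a ((a * s + a * s) + E) →
    (0ℚ < a - s) × (0ℚ < (a * c + a * c) - E) ×
    ((a + s) * ((a * c + a * c) + E) < (a * a) * ((a - s) * ((a * c + a * c) - E)))
  padé-conditions {a} {c} {s} {E} 1≤a a≤c 0≤s 0≤E margin = 0<a-s , 0<2ac-E , key
    where
    open ≤-Reasoning
    0<a : 0ℚ < a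
    0<a = <-≤-trans 0<1 1≤a
    0≤a : 0ℚ ≤ a
    0≤a = <⇒≤ 0<a
    0<a²+1 : 0ℚ < a * a + 1ℚ
    0<a²+1 = +-mono-<-≤ (*-pos 0<a 0<a) 0≤1
    0≤4a² : 0ℚ ≤ (a * a + a * a) + (a * a + a * a)
    0≤4a² = +-mono-≤ (+-mono-≤ a² a²) (+-mono-≤ a² a²)
      where a² = *-nonNeg 0≤a 0≤a
    0≤c-a : 0ℚ ≤ c - a
    0≤c-a = p≤q⇒0≤q-p a≤c
    0≤a²-1 : 0ℚ ≤ a * a - 1ℚ
    0≤a²-1 = p≤q⇒0≤q-p (*-mono-≤′ 0≤1 0≤a 1≤a 1≤a)
    0<gap : 0ℚ < (a * a) * ((a * a - 1ℚ) + (a * a - 1ℚ)) - (a * a + 1ℚ) * ((a * s + a * s) + E)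
    0<gap = p<q⇒0<q-p margin
    0<a-s : 0ℚ < a - s
    0<a-s = 0<p*r⇒0<p (*-pos (+-mono-<-≤ 0<a 0≤a) 0<a²+1) (begin-strict
      0ℚ
        <⟨ +-mono-<-≤ 0<gap (+-mono-≤ (*-nonNeg (<⇒≤ 0<a²+1) 0≤E) 0≤4a²) ⟩
      ((a * a) * ((a * a - 1ℚ) + (a * a - 1ℚ)) - (a * a + 1ℚ) * ((a * s + a * s) + E))
        + ((a * a + 1ℚ) * E + ((a * a + a * a) + (a * a + a * a)))
        ≡⟨ solve (a ∷ s ∷ E ∷ []) ℚ-ring ⟩
      (a - s) * ((a + a) * (a * a + 1ℚ)) ∎)
    0<2ac-E : 0ℚ < (a * c + a * c) - E
    0<2ac-E = 0<p*r⇒0<p 0<a²+1 (begin-strict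
      0ℚ
        <⟨ +-mono-<-≤ 0<gap (+-mono-≤ (*-nonNeg (+-mono-≤ (*-nonNeg 0≤a 0≤s) (*-nonNeg 0≤a 0≤s)) (<⇒≤ 0<a²+1))
                                 (+-mono-≤ (*-nonNeg (*-nonNeg (+-mono-≤ 0≤a 0≤a) 0≤c-a) (<⇒≤ 0<a²+1)) 0≤4a²)) ⟩
      ((a * a) * ((a * a - 1ℚ) + (a * a - 1ℚ)) - (a * a + 1ℚ) * ((a * s + a * s) + E))
        + ((a * s + a * s) * (a * a + 1ℚ) + ((a + a) * (c - a) * (a * a + 1ℚ) + ((a * a + a * a) + (a * a + a * a))))
        ≡⟨ solve (a ∷ c ∷ s ∷ E ∷ []) ℚ-ring ⟩
      ((a * c + a * c) - E) * (a * a + 1ℚ) ∎)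
    key : (a + s) * ((a * c + a * c) + E) < (a * a) * ((a - s) * ((a * c + a * c) - E))
    key = 0<q-p⇒p<q (begin-strict
      0ℚ
        <⟨ +-mono-<-≤ (*-pos (<-≤-trans 0<a a≤c) 0<gap)
             (+-mono-≤ (*-nonNeg (*-nonNeg 0≤c-a (<⇒≤ 0<a²+1)) 0≤E) (*-nonNeg (*-nonNeg 0≤s 0≤a²-1) 0≤E)) ⟩
      c * ((a * a) * ((a * a - 1ℚ) + (a * a - 1ℚ)) - (a * a + 1ℚ) * ((a * s + a * s) + E))
        + ((c - a) * (a * a + 1ℚ) * E + s * (a * a - 1ℚ) * E)
        ≡⟨ solve (a ∷ c ∷ s ∷ E ∷ []) ℚ-ring ⟩
      (a * a) * ((a - s) * ((a * c + a * c) - E)) - (a + s) * ((a * c + a * c) + E) ∎)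

  belowMargin-linear : ∀ {a Y₁ Y₂} → 1ℚ ≤ a → 0ℚ ≤ Y₁ → 0ℚ ≤ Y₂ →
    Y₁ + Y₂ < (a - 1ℚ) + (a - 1ℚ) → BelowMargin a (a * Y₁ + Y₂)
  belowMargin-linear {a} {Y₁} {Y₂} 1≤a 0≤Y₁ 0≤Y₂ Y₁+Y₂<2[a-1] = begin-strict
    (a * a + 1ℚ) * (a * Y₁ + Y₂)                     ≡⟨ solve (a ∷ Y₁ ∷ Y₂ ∷ []) ℚ-ring ⟩
    ((a * a + 1ℚ) * a) * Y₁ + (a * a + 1ℚ) * Y₂      ≤⟨ +-mono-≤ (*-monoʳ-≤′ 0≤Y₁ [a²+1]a≤a²[a+1])
                                                                 (*-monoʳ-≤′ 0≤Y₂ a²+1≤a²[a+1]) ⟩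
    (a * a * (a + 1ℚ)) * Y₁ + (a * a * (a + 1ℚ)) * Y₂ ≡⟨ *-distribˡ-+ (a * a * (a + 1ℚ)) Y₁ Y₂ ⟨
    (a * a * (a + 1ℚ)) * (Y₁ + Y₂)                   <⟨ *-monoˡ-<′ (*-pos (*-pos 0<a 0<a) (+-mono-<-≤ 0<a 0≤1)) Y₁+Y₂<2[a-1] ⟩
    (a * a * (a + 1ℚ)) * ((a - 1ℚ) + (a - 1ℚ))       ≡⟨ solve (a ∷ []) ℚ-ring ⟩
    (a * a) * ((a * a - 1ℚ) + (a * a - 1ℚ))          ∎
    where
    open ≤-Reasoning
    0<a : 0ℚ < a
    0<a = <-≤-trans 0<1 1≤a
    0≤a : 0ℚ ≤ a
    0≤a = <⇒≤ 0<a
    0≤a-1 : 0ℚ ≤ a - 1ℚ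
    0≤a-1 = p≤q⇒0≤q-p 1≤a
    [a²+1]a≤a²[a+1] : (a * a + 1ℚ) * a ≤ a * a * (a + 1ℚ)
    [a²+1]a≤a²[a+1] = 0≤q-p⇒p≤q (begin
      0ℚ                                           ≤⟨ *-nonNeg 0≤a 0≤a-1 ⟩
      a * (a - 1ℚ)                                 ≡⟨ solve (a ∷ []) ℚ-ring ⟩
      a * a * (a + 1ℚ) - (a * a + 1ℚ) * a          ∎)
    a²+1≤a²[a+1] : a * a + 1ℚ ≤ a * a * (a + 1ℚ)
    a²+1≤a²[a+1] = 0≤q-p⇒p≤q (begin
      0ℚ                                           ≤⟨ *-nonNeg 0≤a-1 (+-mono-≤ (+-mono-≤ (*-nonNeg 0≤a 0≤a) 0≤a) 0≤1) ⟩
      (a - 1ℚ) * ((a * a + a) + 1ℚ)                ≡⟨ solve (a ∷ []) ℚ-ring ⟩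
      a * a * (a + 1ℚ) - (a * a + 1ℚ)              ∎)

  small-t-bound : ∀ {t M} → 0ℚ < t → (fromℕ 3 * M + 1ℚ) * t ≤ fromℕ 2 → fromℕ 8 * t ≤ 1ℚ →
    fromℕ 3 * (t * t) * M + fromℕ 3 * (t * t) * (fromℕ 4 * (t * t)) < t + t
  small-t-bound {t} {M} 0<t [3M+1]t≤2 8t≤1 = begin-strict
    fromℕ 3 * (t * t) * M + fromℕ 3 * (t * t) * (fromℕ 4 * (t * t))
      <⟨ 0<q-p⇒p<q (begin-strict
           0ℚ                                   <⟨ *-pos 0<t² (p<q⇒0<q-p 12t²<1) ⟩
           (t * t) * (1ℚ - fromℕ 12 * (t * t))   ≡⟨ solve (t ∷ M ∷ []) ℚ-ring ⟩
           t * ((fromℕ 3 * M + 1ℚ) * t) - (fromℕ 3 * (t * t) * M + fromℕ 3 * (t * t) * (fromℕ 4 * (t * t))) ∎) ⟩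
    t * ((fromℕ 3 * M + 1ℚ) * t)   ≤⟨ *-monoˡ-≤′ (<⇒≤ 0<t) [3M+1]t≤2 ⟩
    t * fromℕ 2                    ≡⟨ solve (t ∷ []) ℚ-ring ⟩
    t + t                          ∎
    where
    open ≤-Reasoning
    0<t² : 0ℚ < t * t
    0<t² = *-pos 0<t 0<t
    12t²<1 : fromℕ 12 * (t * t) < 1ℚ
    12t²<1 = begin-strict
      fromℕ 12 * (t * t)             <⟨ *-monoʳ-<′ 0<t² (fromℕ-mono-< (ℕₚ.m≤m+n 13 51)) ⟩
      fromℕ 64 * (t * t)             ≡⟨ solve (t ∷ []) ℚ-ring ⟩
      (fromℕ 8 * t) * (fromℕ 8 * t)  ≤⟨ *-mono-≤′ (*-nonNeg (fromℕ-nonNeg 8) (<⇒≤ 0<t)) 0≤1 8t≤1 8t≤1 ⟩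
      1ℚ * 1ℚ                        ≡⟨ *-identityʳ 1ℚ ⟩
      1ℚ                             ∎

  belowMargin-small-t : ∀ {a t M} → 0ℚ < t → 0ℚ ≤ M → 1ℚ + t ≤ a →
    (fromℕ 3 * M + 1ℚ) * t ≤ fromℕ 2 → fromℕ 8 * t ≤ 1ℚ →
    BelowMargin a (fromℕ 3 * (t * t) * (a * M + fromℕ 4 * (t * t)))
  belowMargin-small-t {a} {t} {M} 0<t 0≤M 1+t≤a [3M+1]t≤2 8t≤1 =
    subst (BelowMargin a) (distribute a t M)
      (belowMargin-linear 1≤a (*-nonNeg 3t² 0≤M) (*-nonNeg 3t² (*-nonNeg (fromℕ-nonNeg 4) t²))
        (<-≤-trans (small-t-bound 0<t [3M+1]t≤2 8t≤1) (+-mono-≤ t≤a-1 t≤a-1)))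
    where
    t² = *-nonNeg (<⇒≤ 0<t) (<⇒≤ 0<t)
    3t² = *-nonNeg (fromℕ-nonNeg 3) t²
    1≤a : 1ℚ ≤ a
    1≤a = ≤-trans (subst (_≤ 1ℚ + t) (+-identityʳ 1ℚ) (+-monoʳ-≤ 1ℚ (<⇒≤ 0<t))) 1+t≤a
    t≤a-1 : t ≤ a - 1ℚ
    t≤a-1 = subst (_≤ a - 1ℚ) ([p+q]-p≡q 1ℚ t) (+-monoˡ-≤ (- 1ℚ) 1+t≤a)
    distribute : ∀ a t M → a * (fromℕ 3 * (t * t) * M) + fromℕ 3 * (t * t) * (fromℕ 4 * (t * t))
                         ≡ fromℕ 3 * (t * t) * (a * M + fromℕ 4 * (t * t))
    distribute = solve-∀ ℚ-ring

  -- The margin expanded in powers of u = a - 49/36 has positive coefficients; 49/36 = H 2 3.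
  belowMargin-m≡2 : ∀ {u} → 0ℚ ≤ u → let a = + 49 / 36 + u in
    BelowMargin a ((+ 3 / 16) * (a * (+ 4 / 1) + (+ 1 / 4)))
  belowMargin-m≡2 {u} 0≤u = 0<q-p⇒p<q (subst (0ℚ <_) (expand u)
    (horner-pos _ _ _ _ _ 0≤u (positive⁻¹ (+ 761945 / 6718464)) (nonNegative⁻¹ (+ 903499 / 93312))
                              (nonNegative⁻¹ (+ 29587 / 1728)) (nonNegative⁻¹ (+ 365 / 36)) (nonNegative⁻¹ (+ 2 / 1))))
    where
    expand : ∀ u →
      (+ 761945 / 6718464) + u * ((+ 903499 / 93312) + u * ((+ 29587 / 1728) + u * ((+ 365 / 36) + u * (+ 2 / 1))))
        ≡ ((+ 49 / 36 + u) * (+ 49 / 36 + u)) * (((+ 49 / 36 + u) * (+ 49 / 36 + u) - 1ℚ) + ((+ 49 / 36 + u) * (+ 49 / 36 + u) - 1ℚ))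
          - ((+ 49 / 36 + u) * (+ 49 / 36 + u) + 1ℚ) * ((+ 3 / 16) * ((+ 49 / 36 + u) * (+ 4 / 1) + (+ 1 / 4)))
    expand = solve-∀ ℚ-ring

  -- As above, around 5/2 ≤ H 1 7 = 363/140.
  belowMargin-m≡1 : ∀ {u} → 0ℚ ≤ u → let a = + 5 / 2 + u in
    BelowMargin a (a * (+ 3 / 1) + 1ℚ)
  belowMargin-m≡1 {u} 0≤u = 0<q-p⇒p<q (subst (0ℚ <_) (expand u)
    (horner-pos _ _ _ _ _ 0≤u (positive⁻¹ (+ 4 / 1)) (nonNegative⁻¹ (+ 203 / 4))
                              (nonNegative⁻¹ (+ 99 / 2)) (nonNegative⁻¹ (+ 17 / 1)) (nonNegative⁻¹ (+ 2 / 1))))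
    where
    expand : ∀ u →
      (+ 4 / 1) + u * ((+ 203 / 4) + u * ((+ 99 / 2) + u * ((+ 17 / 1) + u * (+ 2 / 1))))
        ≡ ((+ 5 / 2 + u) * (+ 5 / 2 + u)) * (((+ 5 / 2 + u) * (+ 5 / 2 + u) - 1ℚ) + ((+ 5 / 2 + u) * (+ 5 / 2 + u) - 1ℚ))
          - ((+ 5 / 2 + u) * (+ 5 / 2 + u) + 1ℚ) * ((+ 5 / 2 + u) * (+ 3 / 1) + 1ℚ)
    expand = solve-∀ ℚ-ring

  ^-mean-value-≤ : ∀ A m → suc A ℕ.^ m ℕ.* suc A ℕ.≤ A ℕ.^ m ℕ.* suc A ℕ.+ m ℕ.* suc A ℕ.^ m
  ^-mean-value-≤ A zero    = ℕₚ.m≤m+n _ _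
  ^-mean-value-≤ A (suc m) = begin
    (B ℕ.* Bᵐ) ℕ.* B                                   ≡⟨ ℕₚ.*-assoc B Bᵐ B ⟩
    B ℕ.* (Bᵐ ℕ.* B)                                   ≤⟨ ℕₚ.*-monoʳ-≤ B (^-mean-value-≤ A m) ⟩
    B ℕ.* (Aᵐ ℕ.* B ℕ.+ m ℕ.* Bᵐ)                      ≡⟨ expand A Aᵐ Bᵐ m ⟩
    A ℕ.* Aᵐ ℕ.* B ℕ.+ Aᵐ ℕ.* B ℕ.+ m ℕ.* (B ℕ.* Bᵐ)   ≤⟨ ℕₚ.+-monoˡ-≤ _ (ℕₚ.+-monoʳ-≤ (A ℕ.* Aᵐ ℕ.* B)
                                                             (ℕₚ.*-monoˡ-≤ B (ℕₚ.^-monoˡ-≤ m (ℕₚ.n≤1+n A)))) ⟩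
    A ℕ.* Aᵐ ℕ.* B ℕ.+ Bᵐ ℕ.* B ℕ.+ m ℕ.* (B ℕ.* Bᵐ)   ≡⟨ collect A Aᵐ Bᵐ m ⟩
    A ℕ.* Aᵐ ℕ.* B ℕ.+ suc m ℕ.* (B ℕ.* Bᵐ)            ∎
    where
    open ℕₚ.≤-Reasoning
    B = suc A
    Bᵐ = B ℕ.^ m
    Aᵐ = A ℕ.^ m
    expand : ∀ A Aᵐ Bᵐ m → suc A ℕ.* (Aᵐ ℕ.* suc A ℕ.+ m ℕ.* Bᵐ)
                        ≡ A ℕ.* Aᵐ ℕ.* suc A ℕ.+ Aᵐ ℕ.* suc A ℕ.+ m ℕ.* (suc A ℕ.* Bᵐ)
    expand = ℕ-Solver.solve-∀
    collect : ∀ A Aᵐ Bᵐ m → A ℕ.* Aᵐ ℕ.* suc A ℕ.+ Bᵐ ℕ.* suc A ℕ.+ m ℕ.* (suc A ℕ.* Bᵐ)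
                         ≡ A ℕ.* Aᵐ ℕ.* suc A ℕ.+ suc m ℕ.* (suc A ℕ.* Bᵐ)
    collect = ℕ-Solver.solve-∀

  [2+d+k]*[2^m]²≤[2+d]*[4+k]^m : ∀ d k j →
    (2 ℕ.+ d ℕ.+ k) ℕ.* (2 ℕ.^ (2 ℕ.+ j) ℕ.* 2 ℕ.^ (2 ℕ.+ j)) ℕ.≤ (2 ℕ.+ d) ℕ.* (4 ℕ.+ k) ℕ.^ (2 ℕ.+ j)
  [2+d+k]*[2^m]²≤[2+d]*[4+k]^m d k zero =
    subst ((2 ℕ.+ d ℕ.+ k) ℕ.* 16 ℕ.≤_) (square d k)
      (ℕₚ.m≤m+n ((2 ℕ.+ d ℕ.+ k) ℕ.* 16) (2 ℕ.* (k ℕ.* k) ℕ.+ 8 ℕ.* (d ℕ.* k) ℕ.+ d ℕ.* (k ℕ.* k)))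
    where
    square : ∀ d k → (2 ℕ.+ d ℕ.+ k) ℕ.* 16 ℕ.+ (2 ℕ.* (k ℕ.* k) ℕ.+ 8 ℕ.* (d ℕ.* k) ℕ.+ d ℕ.* (k ℕ.* k))
                   ≡ (2 ℕ.+ d) ℕ.* ((4 ℕ.+ k) ℕ.* ((4 ℕ.+ k) ℕ.* 1))
    square = ℕ-Solver.solve-∀
  [2+d+k]*[2^m]²≤[2+d]*[4+k]^m d k (suc j) = begin
    (2 ℕ.+ d ℕ.+ k) ℕ.* ((2 ℕ.* T) ℕ.* (2 ℕ.* T))   ≡⟨ pull-4 (2 ℕ.+ d ℕ.+ k) T ⟩
    4 ℕ.* ((2 ℕ.+ d ℕ.+ k) ℕ.* (T ℕ.* T))           ≤⟨ ℕₚ.*-monoʳ-≤ 4 ([2+d+k]*[2^m]²≤[2+d]*[4+k]^m d k j) ⟩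
    4 ℕ.* ((2 ℕ.+ d) ℕ.* F)                         ≤⟨ ℕₚ.*-monoˡ-≤ ((2 ℕ.+ d) ℕ.* F) (ℕₚ.m≤m+n 4 k) ⟩
    (4 ℕ.+ k) ℕ.* ((2 ℕ.+ d) ℕ.* F)                 ≡⟨ ℕₚ.*-comm (4 ℕ.+ k) ((2 ℕ.+ d) ℕ.* F) ⟩
    ((2 ℕ.+ d) ℕ.* F) ℕ.* (4 ℕ.+ k)                 ≡⟨ ℕₚ.*-assoc (2 ℕ.+ d) F (4 ℕ.+ k) ⟩
    (2 ℕ.+ d) ℕ.* (F ℕ.* (4 ℕ.+ k))                 ≡⟨ cong ((2 ℕ.+ d) ℕ.*_) (ℕₚ.*-comm F (4 ℕ.+ k)) ⟩
    (2 ℕ.+ d) ℕ.* (4 ℕ.+ k) ℕ.^ (3 ℕ.+ j)           ∎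
    where
    open ℕₚ.≤-Reasoning
    T = 2 ℕ.^ (2 ℕ.+ j)
    F = (4 ℕ.+ k) ℕ.^ (2 ℕ.+ j)
    pull-4 : ∀ c T → c ℕ.* ((2 ℕ.* T) ℕ.* (2 ℕ.* T)) ≡ 4 ℕ.* (c ℕ.* (T ℕ.* T))
    pull-4 = ℕ-Solver.solve-∀

  3*[2+m]+1≤2*2^m : ∀ j → 3 ℕ.* (2 ℕ.+ (3 ℕ.+ j)) ℕ.+ 1 ℕ.≤ 2 ℕ.* 2 ℕ.^ (3 ℕ.+ j)
  3*[2+m]+1≤2*2^m zero    = ℕₚ.≤-refl
  3*[2+m]+1≤2*2^m (suc j) = begin
    3 ℕ.* (2 ℕ.+ (4 ℕ.+ j)) ℕ.+ 1                   ≡⟨ ℕ-Solver.solve (j ∷ []) ⟩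
    (3 ℕ.* (2 ℕ.+ (3 ℕ.+ j)) ℕ.+ 1) ℕ.+ 3           ≤⟨ ℕₚ.+-mono-≤ (3*[2+m]+1≤2*2^m j) 3≤2*2^m ⟩
    2 ℕ.* 2 ℕ.^ (3 ℕ.+ j) ℕ.+ 2 ℕ.* 2 ℕ.^ (3 ℕ.+ j)  ≡⟨ double (2 ℕ.^ (3 ℕ.+ j)) ⟩
    2 ℕ.* 2 ℕ.^ (4 ℕ.+ j)                           ∎
    where
    open ℕₚ.≤-Reasoning
    3≤2*2^m : 3 ℕ.≤ 2 ℕ.* 2 ℕ.^ (3 ℕ.+ j)
    3≤2*2^m = ℕₚ.≤-trans (ℕₚ.m≤m+n 3 13) (ℕₚ.*-monoʳ-≤ 2 (ℕₚ.^-monoʳ-≤ 2 (ℕₚ.m≤m+n 3 j)))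
    double : ∀ x → 2 ℕ.* x ℕ.+ 2 ℕ.* x ≡ 2 ℕ.* (2 ℕ.* x)
    double = ℕ-Solver.solve-∀

  -- (n+1)^(-m), so that H m (suc n) = H m n + invPow m n definitionally
  invPow : ℕ → ℕ → ℚ
  invPow m n = (+ 1 / suc n ℕ.^ m) {{ℕₚ.m^n≢0 (suc n) m}}

  invPow-pos : ∀ m n → 0ℚ < invPow m n
  invPow-pos m n = positive⁻¹ _ {{normalize-pos 1 (suc n ℕ.^ m) {{ℕₚ.m^n≢0 (suc n) m}}}}

  invPow-nonNeg : ∀ m n → 0ℚ ≤ invPow m n
  invPow-nonNeg m n = <⇒≤ (invPow-pos m n)

  fromℕ-*-invPow : ∀ m n → fromℕ (suc n ℕ.^ m) * invPow m n ≡ 1ℚ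
  fromℕ-*-invPow m n = fromℕ-*-inverse (suc n ℕ.^ m) {{ℕₚ.m^n≢0 (suc n) m}}

  invPow-antitone : ∀ m n → invPow m (suc n) ≤ invPow m n
  invPow-antitone m n = fromℕ-≤-cleared (p * q) (*-nonNeg (invPow-nonNeg m n) (invPow-nonNeg m (suc n)))
    (begin
      fromℕ (suc n ℕ.^ m) * (p * q)   ≡⟨ *-assoc (fromℕ (suc n ℕ.^ m)) p q ⟨
      fromℕ (suc n ℕ.^ m) * p * q     ≡⟨ cong (_* q) (fromℕ-*-invPow m n) ⟩
      1ℚ * q                          ≡⟨ *-identityˡ q ⟩
      q                               ∎)
    (begin
      fromℕ (suc (suc n) ℕ.^ m) * (p * q)   ≡⟨ cong (fromℕ (suc (suc n) ℕ.^ m) *_) (*-comm p q) ⟩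
      fromℕ (suc (suc n) ℕ.^ m) * (q * p)   ≡⟨ *-assoc (fromℕ (suc (suc n) ℕ.^ m)) q p ⟨
      fromℕ (suc (suc n) ℕ.^ m) * q * p     ≡⟨ cong (_* p) (fromℕ-*-invPow m (suc n)) ⟩
      1ℚ * p                                ≡⟨ *-identityˡ p ⟩
      p                                     ∎)
    (ℕₚ.^-monoˡ-≤ m (ℕₚ.n≤1+n (suc n)))
    where
    open ≡-Reasoning
    p = invPow m n
    q = invPow m (suc n)

  H-nonNeg : ∀ m n → 0ℚ ≤ H m n
  H-nonNeg m zero    = ≤-refl
  H-nonNeg m (suc n) = +-mono-≤ (H-nonNeg m n) (invPow-nonNeg m n)

  H-step : ∀ m n → H m n ≤ H m (suc n)
  H-step m n = subst (_≤ H m (suc n)) (+-identityʳ (H m n)) (+-monoʳ-≤ (H m n) (invPow-nonNeg m n))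

  H-mono : ∀ m {i j} → i ℕ.≤ j → H m i ≤ H m j
  H-mono m {j = zero}  ℕ.z≤n = ≤-refl
  H-mono m {j = suc j} i≤1+j with ℕₚ.m≤n⇒m<n∨m≡n i≤1+j
  ... | inj₁ (ℕ.s≤s i≤j) = ≤-trans (H-mono m i≤j) (H-step m j)
  ... | inj₂ refl        = ≤-refl

  H-1 : ∀ m → H m 1 ≡ 1ℚ
  H-1 m = trans (+-identityˡ _) (1/-cong (ℕₚ.^-zeroˡ m) {{ℕₚ.m^n≢0 1 m}})
    where
    1/-cong : ∀ {X Y} → X ≡ Y → .{{_ : ℕ.NonZero X}} .{{_ : ℕ.NonZero Y}} → + 1 / X ≡ + 1 / Y
    1/-cong refl = refl

  1≤H : ∀ m {n} → 1 ℕ.≤ n → 1ℚ ≤ H m n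
  1≤H m {n} 1≤n = subst (_≤ H m n) (H-1 m) (H-mono m 1≤n)

  1+2⁻ᵐ≤H : ∀ m {n} → 2 ℕ.≤ n → 1ℚ + invPow m 1 ≤ H m n
  1+2⁻ᵐ≤H m {n} 2≤n = subst (_≤ H m n) (cong (_+ invPow m 1) (H-1 m)) (H-mono m 2≤n)

  HarmonicMargin : ℕ → ℕ → Set
  HarmonicMargin m n =
    let a = H m n ; p = invPow m n ; q = invPow m (suc n) ; s = fromℕ n * p in
    BelowMargin a ((a * s + a * s) + fromℕ (n ℕ.* suc n) * (a * (p - q) + p * p))

  harmonic-strictlyLogConvexRoots : ∀ m {n} → 1 ℕ.≤ n → HarmonicMargin m n →
    StrictlyLogConvexRoots n (H m n) (H m (suc n)) (H m (suc (suc n)))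
  harmonic-strictlyLogConvexRoots m {n} 1≤n margin =
    let 0<a-s , 0<2ac-E , key = padé-conditions (1≤H m 1≤n) (H-mono m (ℕₚ.m≤n+m n 2)) 0≤s 0≤E margin
    in padé-criterion n (<-≤-trans 0<1 (1≤H m 1≤n)) 0≤p (invPow-nonNeg m (suc n)) q≤p 0<a-s 0<2ac-E key
    where
    q≤p = invPow-antitone m n
    0≤p = invPow-nonNeg m n
    0≤s = *-nonNeg (fromℕ-nonNeg n) 0≤p
    0≤E = *-nonNeg (fromℕ-nonNeg (n ℕ.* suc n))
            (+-mono-≤ (*-nonNeg (H-nonNeg m n) (p≤q⇒0≤q-p q≤p)) (*-nonNeg 0≤p 0≤p))

  harmonicMargin⇒term-<Q : ∀ m k → HarmonicMargin m (suc k) → term m k <Q term m (suc k)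
  harmonicMargin⇒term-<Q m k margin = strictlyLogConvexRoots⇒<ᴿ k (H-nonNeg m (suc (suc k)))
    (harmonic-strictlyLogConvexRoots m {suc k} (ℕ.s≤s ℕ.z≤n) margin)

  invPow-mean-value : ∀ m n → invPow m n - invPow m (suc n) ≤ fromℕ m * invPow m n * (+ 1 / suc (suc n))
  invPow-mean-value m n = begin
    p - q               ≤⟨ +-monoˡ-≤ (- q) p≤q+μpr ⟩
    (q + μ * p * r) - q ≡⟨ [p+q]-p≡q q (μ * p * r) ⟩
    μ * p * r           ∎
    where
    open ≤-Reasoning
    p = invPow m n
    q = invPow m (suc n)
    r = + 1 / suc (suc n)
    μ = fromℕ m
    A = fromℕ (suc (suc n) ℕ.^ m)
    B = fromℕ (suc (suc n))
    P = fromℕ (suc n ℕ.^ m)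
    Aq≡1 = fromℕ-*-invPow m (suc n)
    Br≡1 = fromℕ-*-inverse (suc (suc n))
    Pp≡1 = fromℕ-*-invPow m n
    regroupˡ : ∀ A B p q r → (A * B) * (p * (q * r)) ≡ p * ((A * q) * (B * r))
    regroupˡ = solve-∀ ℚ-ring
    regroupʳ : ∀ A B P μ p q r → (P * B + μ * A) * (p * (q * r)) ≡ q * ((P * p) * (B * r)) + (μ * p * r) * (A * q)
    regroupʳ = solve-∀ ℚ-ring
    p≤q+μpr : p ≤ q + μ * p * r
    p≤q+μpr = fromℕ-≤-cleared (p * (q * r))
      (*-nonNeg (invPow-nonNeg m n) (*-nonNeg (invPow-nonNeg m (suc n)) (<⇒≤ (positive⁻¹ r {{normalize-pos 1 (suc (suc n))}}))))
      (begin-equality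
        fromℕ (suc (suc n) ℕ.^ m ℕ.* suc (suc n)) * (p * (q * r))  ≡⟨ cong (_* (p * (q * r))) (fromℕ-* (suc (suc n) ℕ.^ m) (suc (suc n))) ⟩
        (A * B) * (p * (q * r))                                   ≡⟨ regroupˡ A B p q r ⟩
        p * ((A * q) * (B * r))                                   ≡⟨ cong₂ (λ x y → p * (x * y)) Aq≡1 Br≡1 ⟩
        p * (1ℚ * 1ℚ)                                             ≡⟨ *-identityʳ p ⟩
        p                                                         ∎)
      (begin-equality
        fromℕ (suc n ℕ.^ m ℕ.* suc (suc n) ℕ.+ m ℕ.* suc (suc n) ℕ.^ m) * (p * (q * r))
          ≡⟨ cong (_* (p * (q * r))) (trans (fromℕ-+ (suc n ℕ.^ m ℕ.* suc (suc n)) (m ℕ.* suc (suc n) ℕ.^ m))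
                                             (cong₂ _+_ (fromℕ-* (suc n ℕ.^ m) (suc (suc n))) (fromℕ-* m (suc (suc n) ℕ.^ m)))) ⟩
        (P * B + μ * A) * (p * (q * r))
          ≡⟨ regroupʳ A B P μ p q r ⟩
        q * ((P * p) * (B * r)) + (μ * p * r) * (A * q)
          ≡⟨ cong₂ (λ x y → q * (x * y) + (μ * p * r) * (A * q)) Pp≡1 Br≡1 ⟩
        q * (1ℚ * 1ℚ) + (μ * p * r) * (A * q)
          ≡⟨ cong₂ _+_ (*-identityʳ q) (trans (cong ((μ * p * r) *_) Aq≡1) (*-identityʳ _)) ⟩
        q + μ * p * r ∎)
      (^-mean-value-≤ (suc n) m)

  invPow-difference-bound : ∀ m n →
    fromℕ (n ℕ.* suc n) * (invPow m n - invPow m (suc n)) ≤ fromℕ m * (fromℕ n * invPow m n)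
  invPow-difference-bound m n = begin
    fromℕ (n ℕ.* suc n) * (p - q)        ≤⟨ *-monoˡ-≤′ (fromℕ-nonNeg (n ℕ.* suc n)) (invPow-mean-value m n) ⟩
    fromℕ (n ℕ.* suc n) * (μ * p * r)    ≡⟨ cong (_* (μ * p * r)) (fromℕ-* n (suc n)) ⟩
    (ν * ν₁) * (μ * p * r)               ≡⟨ regroup ν ν₁ μ p r ⟩
    (μ * (ν * p)) * (ν₁ * r)             ≤⟨ *-monoˡ-≤′ 0≤μνp ν₁r≤1 ⟩
    (μ * (ν * p)) * 1ℚ                   ≡⟨ *-identityʳ _ ⟩
    μ * (ν * p)                          ∎
    where
    open ≤-Reasoning
    p = invPow m n
    q = invPow m (suc n)
    r = + 1 / suc (suc n)
    μ = fromℕ m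
    ν = fromℕ n
    ν₁ = fromℕ (suc n)
    regroup : ∀ ν ν₁ μ p r → (ν * ν₁) * (μ * p * r) ≡ (μ * (ν * p)) * (ν₁ * r)
    regroup = solve-∀ ℚ-ring
    0≤μνp : 0ℚ ≤ μ * (ν * p)
    0≤μνp = *-nonNeg (fromℕ-nonNeg m) (*-nonNeg (fromℕ-nonNeg n) (invPow-nonNeg m n))
    ν₁r≤1 : ν₁ * r ≤ 1ℚ
    ν₁r≤1 = fromℕ-≤-cleared r (<⇒≤ (positive⁻¹ r {{normalize-pos 1 (suc (suc n))}}))
      refl (fromℕ-*-inverse (suc (suc n))) (ℕₚ.n≤1+n (suc n))

  harmonicMargin-reduction : ∀ m n → let a = H m n ; p = invPow m n in
    BelowMargin a ((fromℕ n * p) * (a * fromℕ (2 ℕ.+ m) + fromℕ (suc n) * p)) → HarmonicMargin m n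
  harmonicMargin-reduction m n = belowMargin-antimono (H-nonNeg m n) (begin
    (a * s + a * s) + fromℕ (n ℕ.* suc n) * (a * (p - q) + p * p)
      ≡⟨ cong (λ x → (a * s + a * s) + x * (a * (p - q) + p * p)) (fromℕ-* n (suc n)) ⟩
    (a * s + a * s) + (ν * ν₁) * (a * (p - q) + p * p)
      ≡⟨ cong (λ x → (a * s + a * s) + x) (split ν ν₁ a p q) ⟩
    (a * s + a * s) + (a * ((ν * ν₁) * (p - q)) + s * k)
      ≡⟨ cong (λ x → (a * s + a * s) + (a * (x * (p - q)) + s * k)) (fromℕ-* n (suc n)) ⟨
    (a * s + a * s) + (a * (fromℕ (n ℕ.* suc n) * (p - q)) + s * k)
      ≤⟨ +-monoʳ-≤ (a * s + a * s) (+-monoˡ-≤ (s * k) (*-monoˡ-≤′ (H-nonNeg m n) (invPow-difference-bound m n))) ⟩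
    (a * s + a * s) + (a * (μ * s) + s * k)
      ≡⟨ collect a s μ k ⟩
    s * (a * (fromℕ 2 + μ) + k)
      ≡⟨ cong (λ x → s * (a * x + k)) (fromℕ-+ 2 m) ⟨
    s * (a * fromℕ (2 ℕ.+ m) + k) ∎)
    where
    open ≤-Reasoning
    a = H m n
    p = invPow m n
    q = invPow m (suc n)
    μ = fromℕ m
    ν = fromℕ n
    ν₁ = fromℕ (suc n)
    s = ν * p
    k = ν₁ * p
    split : ∀ ν ν₁ a p q → (ν * ν₁) * (a * (p - q) + p * p) ≡ a * ((ν * ν₁) * (p - q)) + (ν * p) * (ν₁ * p)
    split = solve-∀ ℚ-ring
    collect : ∀ a s μ k → (a * s + a * s) + (a * (μ * s) + s * k) ≡ s * (a * (fromℕ 2 + μ) + k)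
    collect = solve-∀ ℚ-ring

  fromℕ*invPow≤fromℕ*[2⁻ᵐ]² : ∀ m n x c → x ℕ.* (2 ℕ.^ m ℕ.* 2 ℕ.^ m) ℕ.≤ c ℕ.* suc n ℕ.^ m →
    fromℕ x * invPow m n ≤ fromℕ c * (invPow m 1 * invPow m 1)
  fromℕ*invPow≤fromℕ*[2⁻ᵐ]² m n x c = fromℕ-≤-cleared (p * (t * t))
    (*-nonNeg (invPow-nonNeg m n) (*-nonNeg (invPow-nonNeg m 1) (invPow-nonNeg m 1)))
    (begin
      fromℕ (x ℕ.* (2 ℕ.^ m ℕ.* 2 ℕ.^ m)) * (p * (t * t))  ≡⟨ cong (_* (p * (t * t))) (trans (fromℕ-* x (2 ℕ.^ m ℕ.* 2 ℕ.^ m))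
                                                                (cong (fromℕ x *_) (fromℕ-* (2 ℕ.^ m) (2 ℕ.^ m)))) ⟩
      (fromℕ x * (T * T)) * (p * (t * t))                 ≡⟨ regroupˡ (fromℕ x) T p t ⟩
      (fromℕ x * p) * ((T * t) * (T * t))                 ≡⟨ cong (λ y → (fromℕ x * p) * (y * y)) (fromℕ-*-invPow m 1) ⟩
      (fromℕ x * p) * (1ℚ * 1ℚ)                           ≡⟨ *-identityʳ (fromℕ x * p) ⟩
      fromℕ x * p                                         ∎)
    (begin
      fromℕ (c ℕ.* suc n ℕ.^ m) * (p * (t * t))           ≡⟨ cong (_* (p * (t * t))) (fromℕ-* c (suc n ℕ.^ m)) ⟩
      (fromℕ c * P) * (p * (t * t))                       ≡⟨ regroupʳ (fromℕ c) P p t ⟩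
      (fromℕ c * (t * t)) * (P * p)                       ≡⟨ cong (fromℕ c * (t * t) *_) (fromℕ-*-invPow m n) ⟩
      (fromℕ c * (t * t)) * 1ℚ                            ≡⟨ *-identityʳ (fromℕ c * (t * t)) ⟩
      fromℕ c * (t * t)                                   ∎)
    where
    open ≡-Reasoning
    p = invPow m n
    t = invPow m 1
    T = fromℕ (2 ℕ.^ m)
    P = fromℕ (suc n ℕ.^ m)
    regroupˡ : ∀ x T p t → (x * (T * T)) * (p * (t * t)) ≡ (x * p) * ((T * t) * (T * t))
    regroupˡ = solve-∀ ℚ-ring
    regroupʳ : ∀ c P p t → (c * P) * (p * (t * t)) ≡ (c * (t * t)) * (P * p)
    regroupʳ = solve-∀ ℚ-ring

  fromℕ*2⁻ᵐ≤fromℕ : ∀ m x c → x ℕ.≤ c ℕ.* 2 ℕ.^ m → fromℕ x * invPow m 1 ≤ fromℕ c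
  fromℕ*2⁻ᵐ≤fromℕ m x c = fromℕ-≤-cleared (invPow m 1) (invPow-nonNeg m 1) refl (begin
    fromℕ (c ℕ.* 2 ℕ.^ m) * invPow m 1          ≡⟨ cong (_* invPow m 1) (fromℕ-* c (2 ℕ.^ m)) ⟩
    fromℕ c * fromℕ (2 ℕ.^ m) * invPow m 1      ≡⟨ *-assoc (fromℕ c) (fromℕ (2 ℕ.^ m)) (invPow m 1) ⟩
    fromℕ c * (fromℕ (2 ℕ.^ m) * invPow m 1)    ≡⟨ cong (fromℕ c *_) (fromℕ-*-invPow m 1) ⟩
    fromℕ c * 1ℚ                                ≡⟨ *-identityʳ (fromℕ c) ⟩
    fromℕ c                                     ∎)
    where open ≡-Reasoning

  harmonicMargin-m≥2 : ∀ j k → let m = 2 ℕ.+ j ; n = 3 ℕ.+ k ; a = H m n ; t = invPow m 1 in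
    BelowMargin a (fromℕ 3 * (t * t) * (a * fromℕ (2 ℕ.+ m) + fromℕ 4 * (t * t))) → HarmonicMargin m n
  harmonicMargin-m≥2 j k margin = harmonicMargin-reduction m n (belowMargin-antimono (H-nonNeg m n)
    (*-mono-≤′ (*-nonNeg (fromℕ-nonNeg n) (invPow-nonNeg m n))
               (+-mono-≤ (*-nonNeg (H-nonNeg m n) (fromℕ-nonNeg (2 ℕ.+ m))) (*-nonNeg (fromℕ-nonNeg 4) t²))
               (fromℕ*invPow≤fromℕ*[2⁻ᵐ]² m n n 3 ([2+d+k]*[2^m]²≤[2+d]*[4+k]^m 1 k j))
               (+-monoʳ-≤ (H m n * fromℕ (2 ℕ.+ m)) (fromℕ*invPow≤fromℕ*[2⁻ᵐ]² m n (suc n) 4 ([2+d+k]*[2^m]²≤[2+d]*[4+k]^m 2 k j))))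
    margin)
    where
    m = 2 ℕ.+ j
    n = 3 ℕ.+ k
    t² = *-nonNeg (invPow-nonNeg m 1) (invPow-nonNeg m 1)

  harmonicMargin-m≥3 : ∀ j k → HarmonicMargin (3 ℕ.+ j) (3 ℕ.+ k)
  harmonicMargin-m≥3 j k = harmonicMargin-m≥2 (suc j) k (belowMargin-small-t (invPow-pos m 1) (fromℕ-nonNeg (2 ℕ.+ m))
    (1+2⁻ᵐ≤H m {3 ℕ.+ k} (ℕ.s≤s (ℕ.s≤s ℕ.z≤n)))
    (subst (λ x → x * invPow m 1 ≤ fromℕ 2) (trans (fromℕ-+ (3 ℕ.* (2 ℕ.+ m)) 1) (cong (_+ 1ℚ) (fromℕ-* 3 (2 ℕ.+ m))))
      (fromℕ*2⁻ᵐ≤fromℕ m (3 ℕ.* (2 ℕ.+ m) ℕ.+ 1) 2 (3*[2+m]+1≤2*2^m j)))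
    (fromℕ*2⁻ᵐ≤fromℕ m 8 1 (subst (8 ℕ.≤_) (sym (ℕₚ.*-identityˡ (2 ℕ.^ m))) (ℕₚ.^-monoʳ-≤ 2 (ℕₚ.m≤m+n 3 j)))))
    where
    m = 3 ℕ.+ j

  harmonicMargin-m≡2 : ∀ k → HarmonicMargin 2 (3 ℕ.+ k)
  harmonicMargin-m≡2 k = harmonicMargin-m≥2 0 k
    (≤-shift (λ a → BelowMargin a ((+ 3 / 16) * (a * (+ 4 / 1) + (+ 1 / 4)))) (H-mono 2 (ℕₚ.m≤m+n 3 k)) belowMargin-m≡2)

  -- H 1 5 and H 1 6 are below 5/2, but the margin still holds there.
  harmonicMargin-m≡1 : ∀ k → HarmonicMargin 1 (5 ℕ.+ k)
  harmonicMargin-m≡1 zero          = toWitness {a? = _ <? _} _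
  harmonicMargin-m≡1 (suc zero)    = toWitness {a? = _ <? _} _
  harmonicMargin-m≡1 (suc (suc k)) = harmonicMargin-reduction 1 n (belowMargin-antimono (H-nonNeg 1 n)
    (≤-trans (*-mono-≤′ (*-nonNeg (fromℕ-nonNeg n) (invPow-nonNeg 1 n))
                        (+-mono-≤ (*-nonNeg (H-nonNeg 1 n) (fromℕ-nonNeg 3)) 0≤1)
                        np≤1 (+-monoʳ-≤ (H 1 n * fromℕ 3) [n+1]p≤1))
             (≤-reflexive (*-identityˡ _)))
    (≤-shift (λ a → BelowMargin a (a * (+ 3 / 1) + 1ℚ))
      (≤-trans (toWitness {a? = + 5 / 2 ≤? H 1 7} _) (H-mono 1 (ℕₚ.m≤m+n 7 k))) belowMargin-m≡1))
    where
    n = 7 ℕ.+ k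
    [n+1]p≤1 : fromℕ (suc n) * invPow 1 n ≤ 1ℚ
    [n+1]p≤1 = fromℕ-≤-cleared (invPow 1 n) (invPow-nonNeg 1 n) refl (fromℕ-*-invPow 1 n)
      (ℕₚ.≤-reflexive (sym (ℕₚ.*-identityʳ (suc n))))
    np≤1 : fromℕ n * invPow 1 n ≤ 1ℚ
    np≤1 = ≤-trans (*-monoʳ-≤′ (invPow-nonNeg 1 n) (fromℕ-mono-≤ (ℕₚ.n≤1+n n))) [n+1]p≤1

  -- For m = 1 and n = 3, 4 the margin inequality fails.
  term-1-2<Q-term-1-3 : term 1 2 <Q term 1 3
  term-1-2<Q-term-1-3 = toWitness {a? = term 1 2 <Q? term 1 3} _

  term-1-3<Q-term-1-4 : term 1 3 <Q term 1 4
  term-1-3<Q-term-1-4 = toWitness {a? = term 1 3 <Q? term 1 4} _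

open HarmonicRatios
open import Data.Nat using (ℕ; zero; suc; pred; _+_; _≤_; s≤s)

theorem1p3 : (m : ℕ) → 1 ≤ m → (n : ℕ) → 3 ≤ n →
    term m (pred n) <Q term m n
theorem1p3 zero ()
theorem1p3 (suc _) _ 0 ()
theorem1p3 (suc _) _ 1 (s≤s ())
theorem1p3 (suc _) _ 2 (s≤s (s≤s ()))
theorem1p3 1 _ 3 _ = term-1-2<Q-term-1-3
theorem1p3 1 _ 4 _ = term-1-3<Q-term-1-4
theorem1p3 1 _ (suc (suc (suc (suc (suc k))))) _ = harmonicMargin⇒term-<Q 1 (4 + k) (harmonicMargin-m≡1 k)
theorem1p3 2 _ (suc (suc (suc k))) _ = harmonicMargin⇒term-<Q 2 (2 + k) (harmonicMargin-m≡2 k)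
theorem1p3 (suc (suc (suc j))) _ (suc (suc (suc k))) _ =
  harmonicMargin⇒term-<Q (3 + j) (2 + k) (harmonicMargin-m≥3 j k)
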